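{- Let $p$ be a prime and $n\geq 1$. Then $\mathcal{G}_{p,n}(x)$ is a monic null polynomial of degree $p^n$ modulo $p^{I_p(n)}$, but it is not a null polynomial modulo $p^{I_p(n)+1}$.
   Context: An integer polynomial $f$ is a null polynomial modulo $m$ if $f(x)\equiv 0\pmod m$ for all integers $x$. For a prime $p$: $I_p(0)=0$, $I_p(n)=\frac{p^n-1}{p-1}$ ($n\ge 1$); $\mathcal{G}_{p,0}(x)=x$ and $\mathcal{G}_{p,n}(x)=\prod_{i=0}^{p-1}\left(\mathcal{G}_{p,n-1}(x)-ip^{I_p(n-1)}\right)$ for $n\geq 1$. -}

module Defs where

open import Data.Nat as ℕ using (ℕ; zero; suc)
open import Data.Integer as ℤ using (ℤ; +_; -_)
open import Data.Integer.Divisibility using (_∣_)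
open import Data.List using (List; []; _∷_; map; upTo; foldr; length; last)
open import Data.Maybe using (Maybe; just; nothing)
open import Relation.Nullary using (yes; no)
open import Data.Nat.ListAction using (sum)

-- Integer polynomials as coefficient lists, lowest degree first.
Poly : Set
Poly = List ℤ

_+P_ : Poly → Poly → Poly
[] +P q = q
(a ∷ p) +P [] = a ∷ p
(a ∷ p) +P (b ∷ q) = (a ℤ.+ b) ∷ (p +P q)

_*P_ : Poly → Poly → Poly
[] *P q = []
(a ∷ p) *P q = map (a ℤ.*_) q +P (+ 0 ∷ (p *P q))

constP : ℤ → Poly
constP c = c ∷ []

Xp : Poly
Xp = + 0 ∷ + 1 ∷ []

prodP : List Poly → Poly
prodP = foldr _*P_ (constP (+ 1))

eval : Poly → ℤ → ℤ
eval [] x = + 0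
eval (a ∷ f) x = a ℤ.+ x ℤ.* eval f x

strip : Poly → Poly
strip [] = []
strip (a ∷ f) with strip f
... | b ∷ r = a ∷ b ∷ r
... | [] with a ℤ.≟ + 0
...   | yes _ = []
...   | no _ = a ∷ []

-- degree (of the zero polynomial: 0 by convention; irrelevant here)
degree : Poly → ℕ
degree f = length (strip f) ℕ.∸ 1

leadCoeff : Poly → ℤ
leadCoeff f with last (strip f)
... | just c = c
... | nothing = + 0

Monic : Poly → Set
Monic f = leadCoeff f ≡ + 1
  where open import Relation.Binary.PropositionalEquality using (_≡_)

NullMod : ℕ → Poly → Set
NullMod m f = ∀ (x : ℤ) → + m ∣ eval f x

-- I_p(n) = (p^n - 1)/(p - 1) = 1 + p + ... + p^(n-1)  (and I_p(0) = 0)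
I : ℕ → ℕ → ℕ
I p n = sum (map (p ℕ.^_) (upTo n))

G : ℕ → ℕ → Poly
G p zero = Xp
G p (suc n) = prodP (map (λ i → G p n +P constP (- (+ (i ℕ.* p ℕ.^ I p n)))) (upTo p))

-- Monicity and degree are bookkeeping on coefficient lists: G_{p,n} is a product of p
-- monic polynomials of degree p^(n-1), each shifted by a constant.
--
-- Nullity: if G_{p,k}(x) = p^(I_p(k)) w then G_{p,k+1}(x) = p^(p I_p(k)) ∏_{i<p} (w - i),
-- and p divides any product of p consecutive integers; as I_p(k+1) = 1 + p I_p(k), this
-- gives p^(I_p(k+1)) ∣ G_{p,k+1}(x).
--
-- Sharpness: G_{p,k}(p^(k+m)) = p^(I_p(k)+m) u with p ∤ u, by induction on k for all m at
-- once. In the factorisation above w = p^(m+1) u, so the factor i = 0 contributes exactly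
-- p^(m+1) and the factors w - i with 0 < i < p are prime to p. The case m = 0 exhibits a
-- value of G_{p,n} that p^(I_p(n)+1) does not divide.

module Submission where

open import Defs
open import Data.Nat using (ℕ; _≥_; _^_; _+_)
open import Data.Nat.Primality using (Prime)
open import Data.Product using (_×_)
open import Relation.Binary.PropositionalEquality using (_≡_)
open import Relation.Nullary using (¬_)

open import Data.Nat as ℕ using (zero; suc; _*_; _≤_; s≤s; NonZero)
import Data.Nat.Properties as ℕₚ
import Data.Nat.Divisibility as ℕ∣
open import Data.Nat.Primality using (euclidsLemma; prime⇒nonZero; ¬prime[1])
open import Data.Nat.ListAction using (sum)
open import Data.Integer as ℤ using (ℤ; +_; -_)
import Data.Integer.Properties as ℤₚ
import Data.Integer.Divisibility as Unsigned
open import Data.Integer.Divisibility.Signed using (_∣_; divides; ∣⇒∣ᵤ; ∣ᵤ⇒∣; ∣m∣n⇒∣m-n; ∣n⇒∣m*n; ∣m⇒∣m*n)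
open import Data.Integer.DivMod using (_%ℕ_; _/ℕ_; a≡a%ℕn+[a/ℕn]*n; n%ℕd<d)
open import Data.Integer.Tactic.RingSolver using (solve-∀)
import Data.Nat.Tactic.RingSolver as ℕ-Solver
open import Data.List using (List; []; _∷_; [_]; _++_; _∷ʳ_; map; foldr; length; last; upTo; applyUpTo)
open import Data.List.Properties using (length-map; length-++; length-upTo; map-cong; map-∘; map-id; map-applyUpTo; map-upTo)
open import Data.List.Membership.Propositional using (_∈_)
open import Data.List.Membership.Propositional.Properties using (∈-map⁺; ∈-upTo⁺)
open import Data.List.Relation.Unary.All using (All; []; _∷_)
open import Data.List.Relation.Unary.All.Properties using (applyUpTo⁺₁; applyUpTo⁺₂; map⁺)
open import Data.List.Relation.Unary.Any using (here; there)
open import Data.Maybe using (just)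
open import Data.Product using (∃-syntax; _,_)
open import Data.Sum as Sum using (_⊎_; [_,_]′)
open import Function using (_∘_; id)
open import Relation.Binary.PropositionalEquality using (refl; sym; trans; cong; cong₂; subst; subst₂; module ≡-Reasoning)

product : List ℤ → ℤ
product = foldr ℤ._*_ (+ 1)

pos-^ : ∀ m n → + (m ^ n) ≡ (+ m) ℤ.^ n
pos-^ m zero = refl
pos-^ m (suc n) = trans (ℤₚ.pos-* m (m ^ n)) (cong (+ m ℤ.*_) (pos-^ m n))

product-map-*ʳ : ∀ c xs → product (map (ℤ._* c) xs) ≡ product xs ℤ.* c ℤ.^ length xs
product-map-*ʳ c [] = refl
product-map-*ʳ c (x ∷ xs) = begin
    x ℤ.* c ℤ.* product (map (ℤ._* c) xs)  ≡⟨ cong (x ℤ.* c ℤ.*_) (product-map-*ʳ c xs) ⟩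
    x ℤ.* c ℤ.* (product xs ℤ.* c ℤ.^ length xs) ≡⟨ regroup x c (product xs) (c ℤ.^ length xs) ⟩
    x ℤ.* product xs ℤ.* (c ℤ.* c ℤ.^ length xs) ∎
  where
  open ≡-Reasoning
  regroup : ∀ a b c d → a ℤ.* b ℤ.* (c ℤ.* d) ≡ a ℤ.* c ℤ.* (b ℤ.* d)
  regroup = solve-∀

∣-product : ∀ {d x xs} → d ∣ x → x ∈ xs → d ∣ product xs
∣-product {xs = _ ∷ xs} d∣x (here refl) = ∣m⇒∣m*n (product xs) d∣x
∣-product {xs = y ∷ _} d∣x (there x∈xs) = ∣n⇒∣m*n y (∣-product d∣x x∈xs)

prime-∣-* : ∀ {p x y} → Prime p → + p ∣ x ℤ.* y → + p ∣ x ⊎ + p ∣ y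
prime-∣-* {p} {x} {y} pp p∣xy =
  Sum.map ∣ᵤ⇒∣ ∣ᵤ⇒∣ (euclidsLemma ℤ.∣ x ∣ ℤ.∣ y ∣ pp (subst (p ℕ∣.∣_) (ℤₚ.abs-* x y) (∣⇒∣ᵤ p∣xy)))

prime-∤-* : ∀ {p x y} → Prime p → ¬ + p ∣ x → ¬ + p ∣ y → ¬ + p ∣ x ℤ.* y
prime-∤-* pp p∤x p∤y = [ p∤x , p∤y ]′ ∘ prime-∣-* pp

prime-∤-product : ∀ {p xs} → Prime p → All (λ x → ¬ + p ∣ x) xs → ¬ + p ∣ product xs
prime-∤-product pp [] p∣1 = ¬prime[1] (subst Prime (ℕ∣.∣1⇒≡1 (∣⇒∣ᵤ p∣1)) pp)
prime-∤-product pp (p∤x ∷ p∤xs) = prime-∤-* pp p∤x (prime-∤-product pp p∤xs)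

∤-minus : ∀ {d a c} → d ∣ a → ¬ d ∣ c → ¬ d ∣ a ℤ.- c
∤-minus {d} {a} {c} d∣a d∤c d∣a-c = d∤c (subst (d ∣_) (cancel a c) (∣m∣n⇒∣m-n d∣a d∣a-c))
  where
  cancel : ∀ a c → a ℤ.- (a ℤ.- c) ≡ c
  cancel = solve-∀

∣-consecutive-product : ∀ p .{{_ : NonZero p}} w → + p ∣ product (map (λ i → w ℤ.- + i) (upTo p))
∣-consecutive-product p w = ∣-product p∣w-r (∈-map⁺ (λ i → w ℤ.- + i) (∈-upTo⁺ (n%ℕd<d w p)))
  where
  p∣w-r : + p ∣ w ℤ.- + (w %ℕ p)
  p∣w-r = divides (w /ℕ p) (trans (cong (ℤ._- + (w %ℕ p)) (a≡a%ℕn+[a/ℕn]*n w p)) (cancel (+ (w %ℕ p)) _))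
    where
    cancel : ∀ r q → r ℤ.+ q ℤ.- r ≡ q
    cancel = solve-∀

eval-+P : ∀ f g x → eval (f +P g) x ≡ eval f x ℤ.+ eval g x
eval-+P [] g x = sym (ℤₚ.+-identityˡ (eval g x))
eval-+P (a ∷ f) [] x = sym (ℤₚ.+-identityʳ _)
eval-+P (a ∷ f) (b ∷ g) x = trans (cong (λ s → a ℤ.+ b ℤ.+ x ℤ.* s) (eval-+P f g x)) (regroup a b x (eval f x) (eval g x))
  where
  regroup : ∀ a b x s t → a ℤ.+ b ℤ.+ x ℤ.* (s ℤ.+ t) ≡ a ℤ.+ x ℤ.* s ℤ.+ (b ℤ.+ x ℤ.* t)
  regroup = solve-∀

eval-map-* : ∀ a f x → eval (map (a ℤ.*_) f) x ≡ a ℤ.* eval f x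
eval-map-* a [] x = sym (ℤₚ.*-zeroʳ a)
eval-map-* a (b ∷ f) x = trans (cong (λ s → a ℤ.* b ℤ.+ x ℤ.* s) (eval-map-* a f x)) (regroup a b x (eval f x))
  where
  regroup : ∀ a b x s → a ℤ.* b ℤ.+ x ℤ.* (a ℤ.* s) ≡ a ℤ.* (b ℤ.+ x ℤ.* s)
  regroup = solve-∀

eval-*P : ∀ f g x → eval (f *P g) x ≡ eval f x ℤ.* eval g x
eval-*P [] g x = refl
eval-*P (a ∷ f) g x = begin
    eval (map (a ℤ.*_) g +P (+ 0 ∷ (f *P g))) x
  ≡⟨ eval-+P (map (a ℤ.*_) g) _ x ⟩
    eval (map (a ℤ.*_) g) x ℤ.+ (+ 0 ℤ.+ x ℤ.* eval (f *P g) x)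
  ≡⟨ cong₂ (λ s t → s ℤ.+ (+ 0 ℤ.+ x ℤ.* t)) (eval-map-* a g x) (eval-*P f g x) ⟩
    a ℤ.* eval g x ℤ.+ (+ 0 ℤ.+ x ℤ.* (eval f x ℤ.* eval g x))
  ≡⟨ regroup a x (eval f x) (eval g x) ⟩
    (a ℤ.+ x ℤ.* eval f x) ℤ.* eval g x ∎
  where
  open ≡-Reasoning
  regroup : ∀ a x s t → a ℤ.* t ℤ.+ (+ 0 ℤ.+ x ℤ.* (s ℤ.* t)) ≡ (a ℤ.+ x ℤ.* s) ℤ.* t
  regroup = solve-∀

eval-constP : ∀ c x → eval (constP c) x ≡ c
eval-constP c x = trans (cong (ℤ._+_ c) (ℤₚ.*-zeroʳ x)) (ℤₚ.+-identityʳ c)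

eval-Xp : ∀ x → eval Xp x ≡ x
eval-Xp x = trans (cong (λ y → + 0 ℤ.+ x ℤ.* y) (eval-constP (+ 1) x)) (trans (ℤₚ.+-identityˡ _) (ℤₚ.*-identityʳ x))

eval-prodP : ∀ fs x → eval (prodP fs) x ≡ product (map (λ f → eval f x) fs)
eval-prodP [] x = eval-constP (+ 1) x
eval-prodP (f ∷ fs) x = trans (eval-*P f (prodP fs) x) (cong (eval f x ℤ.*_) (eval-prodP fs x))

MonicOfDegree : ℕ → Poly → Set
MonicOfDegree d f = ∃[ g ] length g ≡ d × f ≡ g ++ [ + 1 ]

last-∷ʳ : ∀ {A : Set} (xs : List A) x → last (xs ∷ʳ x) ≡ just x
last-∷ʳ [] x = refl
last-∷ʳ (_ ∷ []) x = refl
last-∷ʳ (_ ∷ y ∷ xs) x = last-∷ʳ (y ∷ xs) x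

strip-monic : ∀ g → strip (g ++ [ + 1 ]) ≡ g ++ [ + 1 ]
strip-monic [] = refl
strip-monic (_ ∷ []) = refl
strip-monic (_ ∷ b ∷ g) rewrite strip-monic (b ∷ g) = refl

MonicOfDegree⇒Monic : ∀ {d f} → MonicOfDegree d f → Monic f
MonicOfDegree⇒Monic (g , _ , refl) rewrite strip-monic g | last-∷ʳ g (+ 1) = refl

MonicOfDegree⇒degree : ∀ {d f} → MonicOfDegree d f → degree f ≡ d
MonicOfDegree⇒degree (g , refl , refl) rewrite strip-monic g | length-++ g {[ + 1 ]} =
  ℕₚ.m+n∸n≡m (length g) 1

length-monic : ∀ {d f} → MonicOfDegree d f → length f ≡ suc d
length-monic (g , refl , refl) = trans (length-++ g) (ℕₚ.+-comm (length g) 1)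

+P-identityʳ : ∀ f → f +P [] ≡ f
+P-identityʳ [] = refl
+P-identityʳ (_ ∷ _) = refl

+P-comm : ∀ f g → f +P g ≡ g +P f
+P-comm [] g = sym (+P-identityʳ g)
+P-comm (_ ∷ _) [] = refl
+P-comm (a ∷ f) (b ∷ g) = cong₂ _∷_ (ℤₚ.+-comm a b) (+P-comm f g)

+P-++ : ∀ u v w → length u ≤ length v → u +P (v ++ w) ≡ (u +P v) ++ w
+P-++ [] v w _ = refl
+P-++ (a ∷ u) (b ∷ v) w (s≤s u≤v) = cong ((a ℤ.+ b) ∷_) (+P-++ u v w u≤v)

length-+P : ∀ u v → length u ≤ length v → length (u +P v) ≡ length v
length-+P [] v _ = refl
length-+P (_ ∷ u) (_ ∷ v) (s≤s u≤v) = cong suc (length-+P u v u≤v)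

+P-monic : ∀ {d f} u → length u ≤ d → MonicOfDegree d f → MonicOfDegree d (u +P f)
+P-monic u u≤d (g , refl , refl) = u +P g , length-+P u g u≤d , +P-++ u g [ + 1 ] u≤d

+P-constP-monic : ∀ {d f} c → 1 ≤ d → MonicOfDegree d f → MonicOfDegree d (f +P constP c)
+P-constP-monic {f = f} c 1≤d f-monic =
  subst (MonicOfDegree _) (+P-comm (constP c) f) (+P-monic (constP c) 1≤d f-monic)

*P-identityˡ : ∀ {d f} → MonicOfDegree d f → constP (+ 1) *P f ≡ f
*P-identityˡ ([] , _ , refl) = refl
*P-identityˡ (a ∷ g , _ , refl) = cong₂ _∷_
  (trans (ℤₚ.+-identityʳ (+ 1 ℤ.* a)) (ℤₚ.*-identityˡ a))
  (trans (+P-identityʳ _) (trans (map-cong ℤₚ.*-identityˡ (g ++ [ + 1 ])) (map-id (g ++ [ + 1 ]))))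

*P-monic : ∀ {a b f q} → MonicOfDegree a f → MonicOfDegree b q → MonicOfDegree (a + b) (f *P q)
*P-monic ([] , refl , refl) q-monic = subst (MonicOfDegree _) (sym (*P-identityˡ q-monic)) q-monic
*P-monic {b = b} {q = q} (c ∷ g , refl , refl) q-monic =
  +P-monic (map (c ℤ.*_) q) c*q≤ (shift (*P-monic (g , refl , refl) q-monic))
  where
  shift : ∀ {d f} → MonicOfDegree d f → MonicOfDegree (suc d) (+ 0 ∷ f)
  shift (h , refl , refl) = + 0 ∷ h , refl , refl
  c*q≤ : length (map (c ℤ.*_) q) ≤ suc (length g + b)
  c*q≤ = ℕₚ.≤-trans (ℕₚ.≤-reflexive (trans (length-map _ q) (length-monic q-monic))) (s≤s (ℕₚ.m≤n+m b (length g)))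

prodP-monic : ∀ {d fs} → All (MonicOfDegree d) fs → MonicOfDegree (length fs * d) (prodP fs)
prodP-monic [] = [] , refl , refl
prodP-monic (f-monic ∷ fs-monic) = *P-monic f-monic (prodP-monic fs-monic)

G-monic : ∀ p .{{_ : NonZero p}} n → MonicOfDegree (p ^ n) (G p n)
G-monic p zero = + 0 ∷ [] , refl , refl
G-monic p (suc n) = subst (λ l → MonicOfDegree (l * p ^ n) (G p (suc n)))
  (trans (length-map _ (upTo p)) (length-upTo p))
  (prodP-monic (map⁺ (applyUpTo⁺₂ id p (λ i → +P-constP-monic _ (ℕₚ.m^n>0 p n) (G-monic p n)))))

sum-map-*ˡ : ∀ c xs → sum (map (c *_) xs) ≡ c * sum xs
sum-map-*ˡ c [] = sym (ℕₚ.*-zeroʳ c)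
sum-map-*ˡ c (x ∷ xs) = trans (cong (_+_ (c * x)) (sum-map-*ˡ c xs)) (sym (ℕₚ.*-distribˡ-+ c x (sum xs)))

I-suc : ∀ p k → I p (suc k) ≡ suc (p * I p k)
I-suc p k = cong suc (begin
    sum (map (p ^_) (applyUpTo suc k))          ≡⟨ cong sum (map-applyUpTo suc (p ^_) k) ⟩
    sum (applyUpTo (λ i → p * p ^ i) k)         ≡⟨ cong sum (map-upTo (λ i → p * p ^ i) k) ⟨
    sum (map (λ i → p * p ^ i) (upTo k))        ≡⟨ cong sum (map-∘ (upTo k)) ⟩
    sum (map (p *_) (map (p ^_) (upTo k)))      ≡⟨ sum-map-*ˡ p (map (p ^_) (upTo k)) ⟩
    p * I p k                                   ∎)
  where open ≡-Reasoning

^-I-suc : ∀ p k → p ^ I p (suc k) ≡ p * (p ^ I p k) ^ p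
^-I-suc p k = begin
    p ^ I p (suc k)         ≡⟨ cong (p ^_) (I-suc p k) ⟩
    p * p ^ (p * I p k)     ≡⟨ cong (λ e → p * p ^ e) (ℕₚ.*-comm p (I p k)) ⟩
    p * p ^ (I p k * p)     ≡⟨ cong (p *_) (ℕₚ.^-*-assoc p (I p k) p) ⟨
    p * (p ^ I p k) ^ p     ∎
  where open ≡-Reasoning

^-I-suc-+ : ∀ p k m → p ^ suc m * (p ^ I p k) ^ p ≡ p ^ (I p (suc k) + m)
^-I-suc-+ p k m = begin
    p * p ^ m * (p ^ I p k) ^ p        ≡⟨ regroup p (p ^ m) ((p ^ I p k) ^ p) ⟩
    p * (p ^ I p k) ^ p * p ^ m        ≡⟨ cong (_* p ^ m) (^-I-suc p k) ⟨
    p ^ I p (suc k) * p ^ m            ≡⟨ ℕₚ.^-distribˡ-+-* p (I p (suc k)) m ⟨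
    p ^ (I p (suc k) + m)              ∎
  where
  open ≡-Reasoning
  regroup : ∀ a b c → a * b * c ≡ a * c * b
  regroup = ℕ-Solver.solve-∀

eval-G-suc : ∀ p k x →
  eval (G p (suc k)) x ≡ product (map (λ i → eval (G p k) x ℤ.- + (i * p ^ I p k)) (upTo p))
eval-G-suc p k x = trans (eval-prodP (map factor (upTo p)) x) (cong product (begin
    map (λ f → eval f x) (map factor (upTo p))  ≡⟨ map-∘ (upTo p) ⟨
    map (λ i → eval (factor i) x) (upTo p)      ≡⟨ map-cong eval-factor (upTo p) ⟩
    map (λ i → eval (G p k) x ℤ.- + (i * p ^ I p k)) (upTo p) ∎))
  where
  open ≡-Reasoning
  factor : ℕ → Poly
  factor i = G p k +P constP (- (+ (i * p ^ I p k)))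
  eval-factor : ∀ i → eval (factor i) x ≡ eval (G p k) x ℤ.- + (i * p ^ I p k)
  eval-factor i = trans (eval-+P (G p k) _ x) (cong (ℤ._+_ (eval (G p k) x)) (eval-constP _ x))

eval-G-suc-factor : ∀ p k x w → eval (G p k) x ≡ w ℤ.* + (p ^ I p k) →
  eval (G p (suc k)) x ≡ product (map (λ i → w ℤ.- + i) (upTo p)) ℤ.* + ((p ^ I p k) ^ p)
eval-G-suc-factor p k x w eq = begin
    eval (G p (suc k)) x                                   ≡⟨ eval-G-suc p k x ⟩
    product (map (λ i → eval (G p k) x ℤ.- + (i * P)) (upTo p)) ≡⟨ cong product (map-cong factor-out (upTo p)) ⟩
    product (map ((ℤ._* + P) ∘ (λ i → w ℤ.- + i)) (upTo p)) ≡⟨ cong product (map-∘ (upTo p)) ⟩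
    product (map (ℤ._* + P) ws)                            ≡⟨ product-map-*ʳ (+ P) ws ⟩
    product ws ℤ.* (+ P) ℤ.^ length ws                     ≡⟨ cong (λ n → product ws ℤ.* (+ P) ℤ.^ n) length-ws ⟩
    product ws ℤ.* (+ P) ℤ.^ p                             ≡⟨ cong (product ws ℤ.*_) (pos-^ P p) ⟨
    product ws ℤ.* + (P ^ p)                               ∎
  where
  open ≡-Reasoning
  P = p ^ I p k
  ws = map (λ i → w ℤ.- + i) (upTo p)
  length-ws : length ws ≡ p
  length-ws = trans (length-map _ (upTo p)) (length-upTo p)
  factor-out : ∀ i → eval (G p k) x ℤ.- + (i * P) ≡ (w ℤ.- + i) ℤ.* + P
  factor-out i = trans (cong₂ ℤ._-_ eq (ℤₚ.pos-* i P)) (distrib w (+ i) (+ P))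
    where
    distrib : ∀ w i P → w ℤ.* P ℤ.- i ℤ.* P ≡ (w ℤ.- i) ℤ.* P
    distrib = solve-∀

G-divisible : ∀ p .{{_ : NonZero p}} k x → + (p ^ I p k) ∣ eval (G p k) x
G-divisible p zero x = divides x (trans (eval-Xp x) (sym (ℤₚ.*-identityʳ x)))
G-divisible p (suc k) x with G-divisible p k x
... | divides w eq with ∣-consecutive-product p w
...   | divides q eq′ = divides q (begin
    eval (G p (suc k)) x
  ≡⟨ eval-G-suc-factor p k x w eq ⟩
    product (map (λ i → w ℤ.- + i) (upTo p)) ℤ.* + (P ^ p)
  ≡⟨ cong (ℤ._* + (P ^ p)) eq′ ⟩
    q ℤ.* + p ℤ.* + (P ^ p)
  ≡⟨ ℤₚ.*-assoc q (+ p) (+ (P ^ p)) ⟩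
    q ℤ.* (+ p ℤ.* + (P ^ p))
  ≡⟨ cong (λ n → q ℤ.* n) (ℤₚ.pos-* p (P ^ p)) ⟨
    q ℤ.* + (p * P ^ p)
  ≡⟨ cong (λ n → q ℤ.* + n) (^-I-suc p k) ⟨
    q ℤ.* + (p ^ I p (suc k)) ∎)
  where
  open ≡-Reasoning
  P = p ^ I p k

G-at-power : ∀ {p} → Prime p → ∀ k m →
  ∃[ u ] ¬ + p ∣ u × eval (G p k) (+ (p ^ (k + m))) ≡ u ℤ.* + (p ^ (I p k + m))
G-at-power {p} pp zero m = + 1 , prime-∤-product pp [] , trans (eval-Xp _) (sym (ℤₚ.*-identityˡ _))
G-at-power {p@(suc q)} pp (suc k) m with G-at-power pp k (suc m)
... | u , p∤u , eq = u ℤ.* R , prime-∤-* pp p∤u p∤R , (begin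
    eval (G p (suc k)) X
  ≡⟨ eval-G-suc-factor p k X (u ℤ.* + S) eq′ ⟩
    -- upTo p unfolds to 0 ∷ applyUpTo suc q: the factor for i = 0 is split off the product.
    (u ℤ.* + S ℤ.- + 0) ℤ.* R ℤ.* + (P ^ p)
  ≡⟨ regroup u (+ S) R (+ (P ^ p)) ⟩
    u ℤ.* R ℤ.* (+ S ℤ.* + (P ^ p))
  ≡⟨ cong (λ n → u ℤ.* R ℤ.* n) (ℤₚ.pos-* S (P ^ p)) ⟨
    u ℤ.* R ℤ.* + (S * P ^ p)
  ≡⟨ cong (λ n → u ℤ.* R ℤ.* + n) (^-I-suc-+ p k m) ⟩
    u ℤ.* R ℤ.* + (p ^ (I p (suc k) + m)) ∎)
  where
  open ≡-Reasoning
  P = p ^ I p k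
  S = p ^ suc m
  X = + (p ^ (suc k + m))
  R = product (map (λ i → u ℤ.* + S ℤ.- + i) (applyUpTo suc q))
  regroup : ∀ u S R Q → (u ℤ.* S ℤ.- + 0) ℤ.* R ℤ.* Q ≡ u ℤ.* R ℤ.* (S ℤ.* Q)
  regroup = solve-∀
  eq′ : eval (G p k) X ≡ u ℤ.* + S ℤ.* + P
  eq′ = begin
      eval (G p k) X
    ≡⟨ cong (λ e → eval (G p k) (+ (p ^ e))) (ℕₚ.+-suc k m) ⟨
      eval (G p k) (+ (p ^ (k + suc m)))
    ≡⟨ eq ⟩
      u ℤ.* + (p ^ (I p k + suc m))
    ≡⟨ cong (λ n → u ℤ.* + n) (trans (ℕₚ.^-distribˡ-+-* p (I p k) (suc m)) (ℕₚ.*-comm P S)) ⟩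
      u ℤ.* + (S * P)
    ≡⟨ cong (u ℤ.*_) (ℤₚ.pos-* S P) ⟩
      u ℤ.* (+ S ℤ.* + P)
    ≡⟨ ℤₚ.*-assoc u (+ S) (+ P) ⟨
      u ℤ.* + S ℤ.* + P ∎
  p∣uS : + p ∣ u ℤ.* + S
  p∣uS = ∣n⇒∣m*n u (divides (+ (p ^ m)) (trans (ℤₚ.pos-* p (p ^ m)) (ℤₚ.*-comm (+ p) (+ (p ^ m)))))
  p∤R : ¬ + p ∣ R
  p∤R = prime-∤-product pp (map⁺ (applyUpTo⁺₁ suc q (λ i<q → ∤-minus p∣uS (ℕ∣.>⇒∤ (s≤s i<q) ∘ ∣⇒∣ᵤ))))

valuation⇒¬NullMod : ∀ {p e f x u} .{{_ : NonZero p}} →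
  ¬ + p ∣ u → eval f x ≡ u ℤ.* + (p ^ e) → ¬ NullMod (p ^ (e + 1)) f
valuation⇒¬NullMod {p} {e} {f} {x} {u} p∤u eq null = p∤u (∣ᵤ⇒∣ (Unsigned.*-cancelʳ-∣ (+ (p ^ e)) {+ p} {u}
  (subst₂ Unsigned._∣_ pᵉ⁺¹≡p*pᵉ eq (null x))))
  where
  instance
    pᵉ≢0 : NonZero (p ^ e)
    pᵉ≢0 = ℕₚ.m^n≢0 p e
  pᵉ⁺¹≡p*pᵉ : + (p ^ (e + 1)) ≡ + p ℤ.* + (p ^ e)
  pᵉ⁺¹≡p*pᵉ = trans (cong (λ k → + (p ^ k)) (ℕₚ.+-comm e 1)) (ℤₚ.pos-* p (p ^ e))

mainTheorem5 : ∀ (p n : ℕ) → Prime p → n ≥ 1 →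
    Monic (G p n) × degree (G p n) ≡ p ^ n × NullMod (p ^ I p n) (G p n)
    × ¬ NullMod (p ^ (I p n + 1)) (G p n)
mainTheorem5 p n pp _ =
  MonicOfDegree⇒Monic (G-monic p n) , MonicOfDegree⇒degree (G-monic p n) , null , not-null
  where
  instance
    p≢0 : NonZero p
    p≢0 = prime⇒nonZero pp
  null : NullMod (p ^ I p n) (G p n)
  null x = ∣⇒∣ᵤ (G-divisible p n x)
  not-null : ¬ NullMod (p ^ (I p n + 1)) (G p n)
  not-null with u , p∤u , eq ← G-at-power pp n 0 =
    valuation⇒¬NullMod {e = I p n} {f = G p n} p∤u
      (trans eq (cong (λ e → u ℤ.* + (p ^ e)) (ℕₚ.+-identityʳ (I p n))))
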